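{- Let $(a,b,c)=(y_{1,0},y_{2,0},y_{3,0})$ be the first diagonal of an arithmetic Y-frieze pattern of width $3$. Then either ($a\le 4$, $c\le 11$ and $b\le 18$) or ($a\le 11$, $c\le 4$ and $b\le 18$).
   Context: A Y-frieze pattern of width $n$ is an array of rational numbers $y_{i,j}$, $i=0,1,\dots,n+1$, $j\in\mathbb{Z}$, arranged in staggered rows (entry $y_{i,j}$ placed at horizontal position $j+i/2$ in row $i$), such that row $0$ and row $n+1$ consist entirely of $0$'s, no row strictly between them consists entirely of $0$'s, and the Y-diamond rule $WE=(1+N)(1+S)$ holds for every diamond, i.e. $y_{i,j}\,y_{i,j+1}=(1+y_{i-1,j+1})(1+y_{i+1,j})$ for $1\le i\le n$, $j\in\mathbb{Z}$. It is arithmetic if all entries in rows $1,\dots,n$ (its non-zero entries) are positive integers. The first diagonal is $(y_{1,0},y_{2,0},\dots,y_{n,0})$. -}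

module Defs where

open import Data.Nat using (ℕ; zero; suc; _+_; _*_; _≤_; _<_)
open import Data.Integer as ℤ using (ℤ)
open import Data.Product using (_×_)
open import Relation.Binary.PropositionalEquality using (_≡_)

-- A Y-frieze pattern of width n is given by entries y i j for rows
-- i = 0 .. n+1 and columns j ∈ ℤ (entries at other rows i > n+1 are ignored).
-- An *arithmetic* Y-frieze has all entries of rows 1..n positive integers
-- and rows 0, n+1 equal to 0, so all entries are natural numbers; we
-- therefore take the entries in ℕ.  Positivity of the interior rows implies
-- that no row strictly between the boundary rows is entirely 0.
record ArithYFrieze (n : ℕ) : Set where
  field
    y         : ℕ → ℤ → ℕ
    row0      : ∀ j → y 0 j ≡ 0
    rowLast   : ∀ j → y (suc n) j ≡ 0
    positive  : ∀ i j → 1 ≤ i → i ≤ n → 1 ≤ y i j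
    diamond   : ∀ k j → k < n →
                y (suc k) j * y (suc k) (j ℤ.+ ℤ.+ 1)
                  ≡ (1 + y k (j ℤ.+ ℤ.+ 1)) * (1 + y (suc (suc k)) j)

-- Along the first diagonal (a, b, c) and its neighbours p = y₁,₁, r = y₂,₁,
-- s = y₃,₁ the diamond rule gives a p = 1 + b, b r = (1 + p)(1 + c) and
-- c s = 1 + r; eliminating p and r leaves b (a c s − a − c − 1) = (a + 1)(c + 1).
-- The boundary diamonds also give a ≤ b + 1 and c ≤ b + 1, which together with
-- this equation force a, c ≤ 7, b ≤ 64 and a c s ≤ 79; the remaining finitely
-- many candidates are checked by evaluation.
module Submission where

open import Defs
open import Data.Nat using (ℕ; _≤_)
open import Data.Integer using (ℤ; +_)
open import Data.Product using (_×_)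
open import Data.Sum using (_⊎_)

open import Data.Integer as ℤ using (-[1+_])
open import Data.Nat using (suc; _+_; _*_; _∸_; _<_; _≤?_; _≟_; >-nonZero; z≤n; s≤s; z<s)
open import Data.Nat.Properties
open import Data.Nat.Divisibility using (_∣_; ∣⇒≤; m∣m*n; n∣m*n)
open import Data.Nat.Tactic.RingSolver using (solve)
open import Data.List using ([]; _∷_)
open import Data.Product using (_,_; ∃-syntax)
open import Data.Empty using (⊥-elim)
open import Relation.Nullary using (¬_; Dec; yes; no)
open import Relation.Nullary.Decidable using (toWitness; _×-dec_; _⊎-dec_; _→-dec_)
open import Relation.Binary.PropositionalEquality

module ArithYFriezeProperties {m : ℕ} (F : ArithYFrieze (suc m)) where
  open ArithYFrieze F

  first-row-diamond : ∀ j → y 1 j * y 1 (j ℤ.+ + 1) ≡ 1 + y 2 j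
  first-row-diamond j = begin
    y 1 j * y 1 (j ℤ.+ + 1)              ≡⟨ diamond 0 j (s≤s z≤n) ⟩
    (1 + y 0 (j ℤ.+ + 1)) * (1 + y 2 j)  ≡⟨ cong (λ x → (1 + x) * (1 + y 2 j)) (row0 _) ⟩
    1 * (1 + y 2 j)                      ≡⟨ *-identityˡ _ ⟩
    1 + y 2 j                            ∎
    where open ≡-Reasoning

  last-row-diamond : ∀ j → y (suc m) j * y (suc m) (j ℤ.+ + 1) ≡ 1 + y m (j ℤ.+ + 1)
  last-row-diamond j = begin
    y (suc m) j * y (suc m) (j ℤ.+ + 1)                  ≡⟨ diamond m j ≤-refl ⟩
    (1 + y m (j ℤ.+ + 1)) * (1 + y (suc (suc m)) j)
      ≡⟨ cong (λ x → (1 + y m (j ℤ.+ + 1)) * (1 + x)) (rowLast j) ⟩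
    (1 + y m (j ℤ.+ + 1)) * 1                            ≡⟨ *-identityʳ _ ⟩
    1 + y m (j ℤ.+ + 1)                                  ∎
    where open ≡-Reasoning

m*n≡1+o⇒m≤1+o : ∀ m n {k} → m * n ≡ suc k → m ≤ suc k
m*n≡1+o⇒m≤1+o m n eq = ∣⇒≤ (subst (m ∣_) eq (m∣m*n n))

m*n≡1+o⇒n≤1+o : ∀ m n {k} → m * n ≡ suc k → n ≤ suc k
m*n≡1+o⇒n≤1+o m n eq = ∣⇒≤ (subst (n ∣_) eq (n∣m*n m))

-- b (a c s − a − c − 1) = (a + 1)(c + 1), with the subtraction moved across.
DiagonalEquation : ℕ → ℕ → ℕ → ℕ → Set
DiagonalEquation a b c s = b * (a * c * s) ≡ b * (a + c + 1) + suc a * suc c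

diagonal-from-diamonds : ∀ {a b c p r s} →
  a * p ≡ 1 + b → b * r ≡ (1 + p) * (1 + c) → c * s ≡ 1 + r → DiagonalEquation a b c s
diagonal-from-diamonds {a} {b} {c} {p} {r} {s} ap bR cs = begin
  b * (a * c * s)                  ≡⟨ solve (a ∷ b ∷ c ∷ s ∷ []) ⟩
  a * b * (c * s)                  ≡⟨ cong (a * b *_) cs ⟩
  a * b * (1 + r)                  ≡⟨ solve (a ∷ b ∷ r ∷ []) ⟩
  a * b + a * (b * r)              ≡⟨ cong (λ x → a * b + a * x) bR ⟩
  a * b + a * ((1 + p) * (1 + c))  ≡⟨ solve (a ∷ b ∷ c ∷ p ∷ []) ⟩
  a * b + (a + a * p) * (1 + c)    ≡⟨ cong (λ x → a * b + (a + x) * (1 + c)) ap ⟩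
  a * b + (a + (1 + b)) * (1 + c)  ≡⟨ solve (a ∷ b ∷ c ∷ []) ⟩
  b * (a + c + 1) + suc a * suc c  ∎
  where open ≡-Reasoning

diagonal-sym : ∀ a b c s → DiagonalEquation a b c s → DiagonalEquation c b a s
diagonal-sym a b c s eq = begin
  b * (c * a * s)                  ≡⟨ solve (a ∷ b ∷ c ∷ s ∷ []) ⟩
  b * (a * c * s)                  ≡⟨ eq ⟩
  b * (a + c + 1) + suc a * suc c  ≡⟨ solve (a ∷ b ∷ c ∷ []) ⟩
  b * (c + a + 1) + suc c * suc a  ∎
  where open ≡-Reasoning

-- In each case the ring identity exhibits one side of the equation as the
-- other plus a positive term.
¬diagonal-equation-large : ∀ a B C s → 1 ≤ a → 1 ≤ s →
  ¬ DiagonalEquation a (7 + B) (8 + C) s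
¬diagonal-equation-large 1 B C 1 _ _ eq = m+1+n≢m _ (trans excess (sym eq))
  where
  excess : (7 + B) * (1 * (8 + C) * 1) + suc (2 * (7 + B) + 2 * (8 + C) + 1)
           ≡ (7 + B) * (1 + (8 + C) + 1) + 2 * suc (8 + C)
  excess = solve (B ∷ C ∷ [])
¬diagonal-equation-large 1 B C (suc (suc S)) _ _ eq = m+1+n≢m _ (trans (sym excess) eq)
  where
  excess : (7 + B) * (1 * (8 + C) * (2 + S))
           ≡ (7 + B) * (1 + (8 + C) + 1) + 2 * suc (8 + C)
             + suc (23 + 5 * C + 6 * B + B * C + (7 + B) * (8 + C) * S)
  excess = solve (B ∷ C ∷ S ∷ [])
¬diagonal-equation-large (suc (suc A)) B C (suc S) _ _ eq = m+1+n≢m _ (trans (sym excess) eq)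
  where
  excess : (7 + B) * ((2 + A) * (8 + C) * (1 + S))
           ≡ (7 + B) * ((2 + A) + (8 + C) + 1) + (3 + A) * suc (8 + C)
             + suc (7 + 40 * A + 4 * C + 6 * A * C + B * (5 + 7 * A + C + A * C)
                    + (7 + B) * ((2 + A) * (8 + C)) * S)
  excess = solve (A ∷ B ∷ C ∷ S ∷ [])

diagonal⇒c≤7 : ∀ {a b c s} → 1 ≤ a → 1 ≤ s → c ≤ suc b →
  DiagonalEquation a b c s → c ≤ 7
diagonal⇒c≤7 {a} {b} {c} {s} 1≤a 1≤s c≤1+b eq with c ≤? 7
... | yes c≤7 = c≤7
... | no c≰7
  with m≤n⇒∃[o]m+o≡n (≰⇒> c≰7) | m≤n⇒∃[o]m+o≡n (≤-pred (≤-trans (≰⇒> c≰7) c≤1+b))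
...   | C , refl | B , refl = ⊥-elim (¬diagonal-equation-large a B C s 1≤a 1≤s eq)

diagonal-excess : ∀ a b c s → DiagonalEquation a b c s →
  ∃[ k ] a * c * s ≡ a + c + 1 + k × b * k ≡ suc a * suc c
diagonal-excess a b c s eq with a + c + 1 ≤? a * c * s
... | yes ≤acs = a * c * s ∸ (a + c + 1) , sym (m+[n∸m]≡n ≤acs) ,
  +-cancelˡ-≡ (b * (a + c + 1)) _ _ (begin
    b * (a + c + 1) + b * (a * c * s ∸ (a + c + 1))  ≡⟨ *-distribˡ-+ b _ _ ⟨
    b * (a + c + 1 + (a * c * s ∸ (a + c + 1)))      ≡⟨ cong (b *_) (m+[n∸m]≡n ≤acs) ⟩
    b * (a * c * s)                                  ≡⟨ eq ⟩
    b * (a + c + 1) + suc a * suc c                  ∎)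
  where open ≡-Reasoning
... | no ≰acs = ⊥-elim (<-irrefl eq (begin-strict
    b * (a * c * s)                  ≤⟨ *-monoʳ-≤ b (<⇒≤ (≰⇒> ≰acs)) ⟩
    b * (a + c + 1)                  <⟨ m<m+n _ z<s ⟩
    b * (a + c + 1) + suc a * suc c  ∎))
  where open ≤-Reasoning

DiagonalBound : ℕ → ℕ → ℕ → Set
DiagonalBound a b c = (a ≤ 4 × c ≤ 11 × b ≤ 18) ⊎ (a ≤ 11 × c ≤ 4 × b ≤ 18)

diagonal-bound? : ∀ a b c → Dec (DiagonalBound a b c)
diagonal-bound? a b c =
  (a ≤? 4 ×-dec c ≤? 11 ×-dec b ≤? 18) ⊎-dec (a ≤? 11 ×-dec c ≤? 4 ×-dec b ≤? 18)

SmallDiagonalClaim : ℕ → ℕ → ℕ → Set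
SmallDiagonalClaim a c s = a * c * s ≤ 79 →
  ∀ {b} → b < 65 → DiagonalEquation a b c s →
  a ≤ suc b → c ≤ suc b → DiagonalBound a b c

small-diagonal-claim? : ∀ a c s → Dec (SmallDiagonalClaim a c s)
small-diagonal-claim? a c s = a * c * s ≤? 79 →-dec allUpTo? (λ b →
  b * (a * c * s) ≟ b * (a + c + 1) + suc a * suc c →-dec
  a ≤? suc b →-dec c ≤? suc b →-dec diagonal-bound? a b c) 65

small-diagonal-claim : ∀ {a} → a < 8 → ∀ {c} → c < 8 → ∀ {s} → s < 80 →
  SmallDiagonalClaim a c s
small-diagonal-claim = toWitness {a? = allUpTo? (λ a → allUpTo? (λ c → allUpTo? (λ s →
  small-diagonal-claim? a c s) 80) 8) 8} _

diagonal-bound : ∀ {a b c s} → 1 ≤ a → 1 ≤ c → 1 ≤ s →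
  a ≤ suc b → c ≤ suc b → DiagonalEquation a b c s → DiagonalBound a b c
diagonal-bound {a} {b} {c} {s} 1≤a 1≤c 1≤s a≤1+b c≤1+b eq
  with diagonal-excess a b c s eq
... | k , acs≡ , bk≡P =
  small-diagonal-claim (s≤s a≤7) (s≤s c≤7) (s≤s (≤-trans s≤acs acs≤79)) acs≤79 (s≤s b≤64)
    eq a≤1+b c≤1+b
  where
  a≤7 : a ≤ 7
  a≤7 = diagonal⇒c≤7 1≤c 1≤s a≤1+b (diagonal-sym a b c s eq)
  c≤7 : c ≤ 7
  c≤7 = diagonal⇒c≤7 1≤a 1≤s c≤1+b eq
  P≤64 : suc a * suc c ≤ 64
  P≤64 = *-mono-≤ (s≤s a≤7) (s≤s c≤7)
  b≤64 : b ≤ 64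
  b≤64 = ≤-trans (m*n≡1+o⇒m≤1+o b k bk≡P) P≤64
  k≤64 : k ≤ 64
  k≤64 = ≤-trans (m*n≡1+o⇒n≤1+o b k bk≡P) P≤64
  acs≤79 : a * c * s ≤ 79
  acs≤79 = ≤-trans (≤-reflexive acs≡)
             (+-mono-≤ (+-mono-≤ (+-mono-≤ a≤7 c≤7) ≤-refl) k≤64)
  s≤acs : s ≤ a * c * s
  s≤acs = m≤n*m s (a * c) {{>-nonZero (*-mono-≤ 1≤a 1≤c)}}

lemma2p3 : (F : ArithYFrieze 3) →
    let open ArithYFrieze F
        a = y 1 (+ 0)
        b = y 2 (+ 0)
        c = y 3 (+ 0)
    in (a ≤ 4 × c ≤ 11 × b ≤ 18) ⊎ (a ≤ 11 × c ≤ 4 × b ≤ 18)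
lemma2p3 F = diagonal-bound
  (positive 1 (+ 0) z<s (s≤s z≤n))
  (positive 3 (+ 0) z<s ≤-refl)
  (positive 3 (+ 1) z<s ≤-refl)
  (m*n≡1+o⇒m≤1+o a p ap) (m*n≡1+o⇒n≤1+o q c qc)
  (diagonal-from-diamonds {a} {b} {c} {p} {r} {s} ap br cs)
  where
  open ArithYFrieze F
  open ArithYFriezeProperties F
  a = y 1 (+ 0)
  b = y 2 (+ 0)
  c = y 3 (+ 0)
  p = y 1 (+ 1)
  q = y 3 -[1+ 0 ]
  r = y 2 (+ 1)
  s = y 3 (+ 1)
  ap : a * p ≡ 1 + b
  ap = first-row-diamond (+ 0)
  br : b * r ≡ (1 + p) * (1 + c)
  br = diamond 1 (+ 0) (s≤s (s≤s z≤n))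
  cs : c * s ≡ 1 + r
  cs = last-row-diamond (+ 0)
  qc : q * c ≡ 1 + b
  qc = last-row-diamond -[1+ 0 ]
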